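{- For every positive integer $n$, there is a temporal graph $G$ on $n$ vertices and a vertex $s$ of $G$ such that every single-source temporal preserver of $G$ with respect to $s$ has size $\Theta(n^2)$.
   Context: A temporal graph is an undirected graph $G=(V,E)$ with $n=|V|$ vertices and a labeling $\lambda:E\to\mathbb{N}^+$. A temporal path from $u$ to $v$ is a path whose traversed edges $e_1,\dots,e_m$ satisfy $\lambda(e_i)\le\lambda(e_{i+1})$ for all $i$; its length is $m$. $d_G(u,v)$ is the minimum length of a temporal path from $u$ to $v$ ($+\infty$ if none). A temporal subgraph $H$ of $G$ has $V(H)=V$, $E(H)\subseteq E$ with the same labels. A single-source temporal preserver of $G$ w.r.t. $s$ is a temporal subgraph $H$ with $d_H(s,v)= d_G(s,v)$ for all $v\in V$. The size of $H$ is $|E(H)|$. -}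

module Defs where

open import Data.Nat using (ℕ; zero; suc; _+_; _*_; _≤_; _<ᵇ_)
open import Data.Fin using (Fin; toℕ)
open import Data.Maybe using (Maybe; just; nothing; is-just)
open import Data.Bool using (Bool; true; false; _∧_; if_then_else_)
open import Data.List using (List; []; _∷_; length; map; allFin)
open import Data.Nat.ListAction using (sum)
open import Data.List.Relation.Unary.Unique.Propositional using (Unique)
open import Data.Product using (Σ; _×_)
open import Data.Unit using (⊤)
open import Data.Empty using (⊥)
open import Relation.Binary.PropositionalEquality using (_≡_)

-- A temporal graph on vertex set Fin n: a simple undirected graph together
-- with a labeling of its edges by positive naturals.  lab i j ≡ just l means
-- {i,j} is an edge with label l; nothing means no edge.
record TGraph (n : ℕ) : Set where
  field
    lab    : Fin n → Fin n → Maybe ℕ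
    sym    : ∀ i j → lab i j ≡ lab j i
    irrefl : ∀ i → lab i i ≡ nothing
    pos    : ∀ i j l → lab i j ≡ just l → 1 ≤ l
open TGraph public

module _ {n : ℕ} (G : TGraph n) where

  TempFrom : ℕ → List (Fin n) → Set
  TempFrom b []            = ⊤
  TempFrom b (x ∷ [])      = ⊤
  TempFrom b (x ∷ y ∷ r)   = Σ ℕ λ l → lab G x y ≡ just l × b ≤ l × TempFrom l (y ∷ r)

end : {n : ℕ} → Fin n → List (Fin n) → Fin n
end u []      = u
end u (x ∷ r) = end x r

record TPath {n : ℕ} (G : TGraph n) (u v : Fin n) (k : ℕ) : Set where
  field
    rest   : List (Fin n)
    len    : length rest ≡ k
    ends   : end u rest ≡ v
    simple : Unique (u ∷ rest)
    temp   : TempFrom G 0 (u ∷ rest)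

-- IsDist G u v d : d_G(u,v) = d, where d = nothing encodes +∞
data IsDist {n : ℕ} (G : TGraph n) (u v : Fin n) : Maybe ℕ → Set where
  finite   : ∀ k → TPath G u v k → (∀ m → TPath G u v m → k ≤ m) → IsDist G u v (just k)
  infinite : (∀ m → TPath G u v m → ⊥) → IsDist G u v nothing

IsTSubgraph : {n : ℕ} → TGraph n → TGraph n → Set
IsTSubgraph H G = ∀ i j l → lab H i j ≡ just l → lab G i j ≡ just l

-- H is a single-source temporal preserver of G w.r.t. s (H assumed a subgraph)
IsPreserver : {n : ℕ} → TGraph n → TGraph n → Fin n → Set
IsPreserver G H s = ∀ v d → IsDist G s v d → IsDist H s v d

edgeInd : {n : ℕ} → TGraph n → Fin n → Fin n → ℕ
edgeInd G i j = if (toℕ i <ᵇ toℕ j) ∧ is-just (lab G i j) then 1 else 0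

size : {n : ℕ} → TGraph n → ℕ
size {n} G = sum (map (λ i → sum (map (λ j → edgeInd G i j) (allFin n))) (allFin n))

-- For each label j ∈ [1, k] the graph contains a route: a temporal path of length L = 8k + 1, all
-- of whose edges carry the label j, from the source s to a terminal t_j of its own.  It runs through
-- the layers A, B, C, D in 2k rounds, round r visiting A(j + r), B(2j + r), C(3j + r), D(2j + r).
-- Every edge is a step of some route, and a node lies on routes with larger labels at smaller
-- positions.  As labels never decrease along a temporal path, each edge advances the position by at
-- most one; hence d(s, t_j) = L, and every temporal path of length L from s to t_j uses exactly the
-- edges of route j.  A preserver therefore keeps the k² edges A(i)B(i + j) with k ≤ i < 2k and
-- 1 ≤ j ≤ k, while the graph needs only 25k + 1 vertices; take k = ⌊n/26⌋.

module Submission where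

open import Defs hiding (sym)
open import Data.Nat
  using (ℕ; zero; suc; _+_; _*_; _∸_; _≤_; _<_; z≤n; s≤s; s≤s⁻¹; z<s; _<ᵇ_; _≤?_; _≟_; NonZero; >-nonZero)
open import Data.Nat.Properties
open import Data.Nat.DivMod
  using ( _/_; _%_; _mod_; m≡m%n+[m/n]*n; m%n<n; [m+kn]%n≡m%n; m<n⇒m%n≡m; +-distrib-/-∣ˡ; m*n/n≡m
        ; m<n⇒m/n≡0; m/n*n≤m; m≥n⇒m/n>0)
open import Data.Nat.Divisibility using (divides-refl)
open import Data.Nat.ListAction using (sum)
open import Data.Nat.Solver using (module +-*-Solver)
open import Data.Bool using (true; false; _∧_)
open import Data.Bool.Properties using (T-≡)
open import Data.Fin using (Fin; toℕ) renaming (zero to fzero; suc to fsuc)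
open import Data.Fin.Properties using (toℕ-injective; toℕ-fromℕ<)
open import Data.Maybe using (Maybe; just; nothing; is-just; _>>=_; _<∣>_)
open import Data.Maybe.Properties using (<∣>-identityʳ)
open import Data.List using (List; []; _∷_; _++_; length; map; allFin; tabulate)
open import Data.List.Properties using (length-map; map-tabulate)
open import Data.List.Relation.Unary.All using (All; []; _∷_)
open import Data.List.Relation.Unary.AllPairs using ([]; _∷_)
open import Data.List.Relation.Unary.Linked using (Linked; []; [-]; _∷_)
import Data.List.Relation.Unary.Linked as Linked
import Data.List.Relation.Unary.Linked.Properties as Linked
open import Data.List.Relation.Unary.Unique.Propositional using (Unique)
open import Data.Product using (Σ; _×_; _,_; proj₁)
open import Data.Sum using (_⊎_; inj₁; inj₂; [_,_]′)
open import Data.Unit using (⊤; tt)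
open import Data.Empty using (⊥)
open import Function using (_∘_; Equivalence)
open import Relation.Binary using (tri<; tri≈; tri>)
open import Relation.Binary.PropositionalEquality
open import Relation.Nullary using (Dec; yes; no; ¬_; contradiction)
open import Relation.Nullary.Decidable using (_×-dec_)
open +-*-Solver

m≡n+o⇒m∸o≡n : ∀ {m n o} → m ≡ n + o → m ∸ o ≡ n
m≡n+o⇒m∸o≡n {n = n} {o} refl = m+n∸n≡m n o

weighted-cancel-≤ : ∀ w {b l r r′} → w * b + r ≡ w * l + r′ → b ≤ l → r′ ≤ r
weighted-cancel-≤ w {b} {l} {r} {r′} eq b≤l = +-cancelˡ-≤ (w * b) r′ r (begin
  w * b + r′ ≤⟨ +-monoˡ-≤ r′ (*-monoʳ-≤ w b≤l) ⟩
  w * l + r′ ≡⟨ eq ⟨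
  w * b + r  ∎)
  where open ≤-Reasoning

weighted-cancel-< : ∀ w .{{_ : NonZero w}} {b l r r′} → w * b + r ≡ w * l + r′ → b < l → r′ < r
weighted-cancel-< w {b} {l} {r} {r′} eq b<l = +-cancelˡ-< (w * b) r′ r (begin-strict
  w * b + r′ <⟨ +-monoˡ-< r′ (*-monoʳ-< w b<l) ⟩
  w * l + r′ ≡⟨ eq ⟨
  w * b + r  ∎)
  where open ≤-Reasoning


-- Counting edges

sum-tabulate-≤ : ∀ {n} (f : Fin n → ℕ) {m} → (∀ i → f i ≤ m) → sum (tabulate f) ≤ n * m
sum-tabulate-≤ {zero}  f bound = z≤n
sum-tabulate-≤ {suc n} f bound = +-mono-≤ (bound fzero) (sum-tabulate-≤ (f ∘ fsuc) (bound ∘ fsuc))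

sum-tabulate-≥ : ∀ {n} (f : Fin n → ℕ) (lo c : ℕ) {m} → lo + c ≤ n →
                 (∀ t → t < c → ∀ i → toℕ i ≡ lo + t → m ≤ f i) → c * m ≤ sum (tabulate f)
sum-tabulate-≥         f lo      zero    _         _     = z≤n
sum-tabulate-≥ {suc n} f zero    (suc c) (s≤s c≤n) bound =
  +-mono-≤ (bound 0 z<s fzero refl)
           (sum-tabulate-≥ (f ∘ fsuc) 0 c c≤n λ t t<c i i≡t → bound (suc t) (s≤s t<c) (fsuc i) (cong suc i≡t))
sum-tabulate-≥ {suc n} f (suc lo) (suc c) (s≤s lo+c≤n) bound =
  ≤-trans (sum-tabulate-≥ (f ∘ fsuc) lo (suc c) lo+c≤n λ t t<c i i≡ → bound t t<c (fsuc i) (cong suc i≡))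
          (m≤n+m _ (f fzero))

sum-allFin : ∀ {n} (f : Fin n → ℕ) → sum (map f (allFin n)) ≡ sum (tabulate f)
sum-allFin f = cong sum (map-tabulate (λ i → i) f)

rowSize : ∀ {n} → TGraph n → Fin n → ℕ
rowSize {n} G x = sum (map (edgeInd G x) (allFin n))

edgeInd≤1 : ∀ {n} (G : TGraph n) x y → edgeInd G x y ≤ 1
edgeInd≤1 G x y with (toℕ x <ᵇ toℕ y) ∧ is-just (lab G x y)
... | true  = ≤-refl
... | false = z≤n

edgeInd≡1 : ∀ {n} (G : TGraph n) {x y l} → toℕ x < toℕ y → lab G x y ≡ just l → edgeInd G x y ≡ 1
edgeInd≡1 G {x} {y} x<y xy rewrite Equivalence.to T-≡ (<⇒<ᵇ x<y) | xy = refl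

size≤n*n : ∀ {n} (G : TGraph n) → size G ≤ n * n
size≤n*n {n} G = subst (_≤ n * n) (sym (sum-allFin (rowSize G))) (sum-tabulate-≤ _ row≤n)
  where
  row≤n : ∀ x → rowSize G x ≤ n
  row≤n x = subst₂ _≤_ (sym (sum-allFin (edgeInd G x))) (*-identityʳ n) (sum-tabulate-≤ _ (edgeInd≤1 G x))

size-≥ : ∀ {n} (G : TGraph n) (lo c : ℕ) (start : ℕ → ℕ) (c′ : ℕ) →
         lo + c ≤ n → (∀ t → t < c → start t + c′ ≤ n) →
         (∀ t u → t < c → u < c′ → ∀ x y → toℕ x ≡ lo + t → toℕ y ≡ start t + u →
            toℕ x < toℕ y × Σ ℕ λ l → lab G x y ≡ just l) →
         c * c′ ≤ size G
size-≥ {n} G lo c start c′ rows≤n cols≤n edge =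
  subst (c * c′ ≤_) (sym (sum-allFin (rowSize G))) (sum-tabulate-≥ _ lo c rows≤n row≥)
  where
  row≥ : ∀ t → t < c → ∀ x → toℕ x ≡ lo + t → c′ ≤ rowSize G x
  row≥ t t<c x x≡ = subst₂ _≤_ (*-identityʳ c′) (sym (sum-allFin (edgeInd G x)))
    (sum-tabulate-≥ _ (start t) c′ (cols≤n t t<c) λ u u<c′ y y≡ →
      let x<y , l , xy = edge t u t<c u<c′ x y x≡ y≡ in ≤-reflexive (sym (edgeInd≡1 G x<y xy)))

-- Temporal walks along routes

module _ {n : ℕ} where

  temp-subgraph : {G H : TGraph n} → IsTSubgraph H G → ∀ {b} xs → TempFrom H b xs → TempFrom G b xs
  temp-subgraph sub []          _                     = tt
  temp-subgraph sub (x ∷ [])    _                     = tt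
  temp-subgraph sub (x ∷ y ∷ r) (l , xy , b≤l , temp) = l , sub x y l xy , b≤l , temp-subgraph sub (y ∷ r) temp

  temp-linked : (G : TGraph n) {j b : ℕ} {xs : List (Fin n)} →
                Linked (λ x y → lab G x y ≡ just j) xs → b ≤ j → TempFrom G b xs
  temp-linked G []          _   = tt
  temp-linked G [-]         _   = tt
  temp-linked G (xy ∷ rest) b≤j = _ , xy , b≤j , temp-linked G rest ≤-refl

-- With OnRoute j p x meaning that the route with label j has x at position p, Follows OnRoute j p xs
-- says that xs lists the vertices of this route from position p on.
data Follows {V : Set} (OnRoute : ℕ → ℕ → V → Set) (j : ℕ) : ℕ → List V → Set where
  [_] : ∀ {p x} → OnRoute j p x → Follows OnRoute j p (x ∷ [])
  _∷_ : ∀ {p x y xs} → OnRoute j p x → Follows OnRoute j (suc p) (y ∷ xs) → Follows OnRoute j p (x ∷ y ∷ xs)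

module _ {V : Set} {OnRoute : ℕ → ℕ → V → Set} where

  follows-head : ∀ {j p x xs} → Follows OnRoute j p (x ∷ xs) → OnRoute j p x
  follows-head [ x ]   = x
  follows-head (x ∷ _) = x

  follows-map : ∀ {W : Set} {OnRoute′ : ℕ → ℕ → W → Set} (f : V → W) {j} →
                (∀ {p v} → OnRoute j p v → OnRoute′ j p (f v)) →
                ∀ {p xs} → Follows OnRoute j p xs → Follows OnRoute′ j p (map f xs)
  follows-map f on [ x ]    = [ on x ]
  follows-map f on (x ∷ xs) = on x ∷ follows-map f on xs

module Routes {n : ℕ} (G : TGraph n) (OnRoute : ℕ → ℕ → Fin n → Set)
  (edge-on-route : ∀ x y {l} → lab G x y ≡ just l → Σ ℕ λ q →
     (OnRoute l q x × OnRoute l (suc q) y) ⊎ (OnRoute l q y × OnRoute l (suc q) x))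
  (later-route-earlier : ∀ {b l p q v} → OnRoute b p v → OnRoute l q v → b ≤ l → q ≤ p)
  (later-route-strictly-earlier : ∀ {b l p q v} → OnRoute b p v → OnRoute l q v → b < l → 1 ≤ p → q < p)
  where

  position-unique : ∀ {j p q v} → OnRoute j p v → OnRoute j q v → p ≡ q
  position-unique v-at-p v-at-q = ≤-antisym (later-route-earlier v-at-q v-at-p ≤-refl) (later-route-earlier v-at-p v-at-q ≤-refl)

  same-position-same-route : ∀ {b l p v} → OnRoute b p v → OnRoute l p v → 1 ≤ p → b ≡ l
  same-position-same-route {b} {l} v-at-b v-at-l 1≤p with <-cmp b l
  ... | tri< b<l _ _ = contradiction (later-route-strictly-earlier v-at-b v-at-l b<l 1≤p) (<-irrefl refl)
  ... | tri≈ _ b≡l _ = b≡l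
  ... | tri> _ _ l<b = contradiction (later-route-strictly-earlier v-at-l v-at-b l<b 1≤p) (<-irrefl refl)

  follows-avoids : ∀ {j p q x xs} → OnRoute j q x → q < p → Follows OnRoute j p xs → All (λ y → ¬ x ≡ y) xs
  follows-avoids x-at-q q<p [ y-at-p ]    = (λ { refl → <-irrefl (position-unique x-at-q y-at-p) q<p }) ∷ []
  follows-avoids x-at-q q<p (y-at-p ∷ ys) =
    (λ { refl → <-irrefl (position-unique x-at-q y-at-p) q<p }) ∷ follows-avoids x-at-q (m<n⇒m<1+n q<p) ys

  follows-unique : ∀ {j p xs} → Follows OnRoute j p xs → Unique xs
  follows-unique [ _ ]    = [] ∷ []
  follows-unique (x ∷ ys) = follows-avoids x (n<1+n _) ys ∷ follows-unique ys

  ≤⊎next⇒≤1+ : ∀ {q p} {A : Set} → q ≤ p ⊎ (q ≡ suc p × A) → q ≤ suc p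
  ≤⊎next⇒≤1+ (inj₁ q≤p)         = m≤n⇒m≤1+n q≤p
  ≤⊎next⇒≤1+ (inj₂ (refl , _)) = ≤-refl

  next-position : ∀ {b l p x y} → lab G x y ≡ just l → OnRoute b p x → b ≤ l →
                  Σ ℕ λ q → OnRoute l q y × (q ≤ p ⊎ (q ≡ suc p × OnRoute l p x))
  next-position {x = x} {y} xy x-at-p b≤l with edge-on-route x y xy
  ... | q , inj₂ (y-at-q , x-at-1+q) = q , y-at-q , inj₁ (<⇒≤ (later-route-earlier x-at-p x-at-1+q b≤l))
  ... | q , inj₁ (x-at-q , y-at-1+q) with m≤n⇒m<n∨m≡n (later-route-earlier x-at-p x-at-q b≤l)
  ...   | inj₁ q<p  = suc q , y-at-1+q , inj₁ q<p
  ...   | inj₂ refl = suc q , y-at-1+q , inj₂ (refl , x-at-q)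

  walk-bound : ∀ {b p x} rest → TempFrom G b (x ∷ rest) → OnRoute b p x →
               Σ ℕ λ b′ → Σ ℕ λ p′ → OnRoute b′ p′ (end x rest) × p′ ≤ p + length rest
  walk-bound {p = p} []         _                     x-at-p = _ , p , x-at-p , m≤m+n p 0
  walk-bound {p = p} (y ∷ rest) (l , xy , b≤l , temp) x-at-p
    with next-position xy x-at-p b≤l
  ... | q , y-at-q , q≤p⊎ with walk-bound rest temp y-at-q
  ...   | b′ , p′ , end-at-p′ , p′≤ = b′ , p′ , end-at-p′ , ≤-trans p′≤ (begin
          q + length rest         ≤⟨ +-monoˡ-≤ (length rest) (≤⊎next⇒≤1+ q≤p⊎) ⟩
          suc p + length rest     ≡⟨ +-suc p (length rest) ⟨
          p + length (y ∷ rest)   ∎)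
    where open ≤-Reasoning

  -- By walk-bound, a walk of the minimal length L must advance by exactly one position at every edge,
  -- that is, take a forward step of the route of the edge's label; and a vertex occupies a given
  -- position ≥ 1 on at most one route, which is therefore route j throughout.
  shortest-walk-follows : ∀ {t j L} → (∀ {b p} → OnRoute b p t → b ≡ j × p ≡ L) →
    ∀ {b p x} rest → TempFrom G b (x ∷ rest) → OnRoute b p x → end x rest ≡ t → p + length rest ≡ L →
    Follows OnRoute j p (x ∷ rest)
  shortest-walk-follows only-end []         _                     x-at-p refl _ with only-end x-at-p
  ... | refl , _ = [ x-at-p ]
  shortest-walk-follows {j = j} {L = L} only-end {p = p} (y ∷ rest) (l , xy , b≤l , temp) x-at-p ends length≡
    with next-position xy x-at-p b≤l
  ... | q , y-at-q , q≤p⊎ with walk-bound rest temp y-at-q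
  ...   | _ , p′ , end-at-p′ , p′≤ with only-end (subst (OnRoute _ p′) ends end-at-p′)
  ...     | _ , refl with q≤p⊎
  ...       | inj₁ q≤p = contradiction (begin-strict
                p + length rest       <⟨ +-monoʳ-< p (n<1+n _) ⟩
                p + length (y ∷ rest) ≡⟨ length≡ ⟩
                L                     ≤⟨ p′≤ ⟩
                q + length rest       ≤⟨ +-monoˡ-≤ (length rest) q≤p ⟩
                p + length rest       ∎) (<-irrefl refl)
    where open ≤-Reasoning
  ...       | inj₂ (refl , x-on-l) = subst (λ l → OnRoute l p _) l≡j x-on-l ∷ tail
    where
    tail : Follows OnRoute j (suc p) (y ∷ rest)
    tail = shortest-walk-follows only-end rest temp y-at-q ends (trans (sym (+-suc p (length rest))) length≡)
    l≡j : l ≡ j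
    l≡j = same-position-same-route y-at-q (follows-head tail) (s≤s z≤n)

  followed-step-is-edge : (H : TGraph n) → (∀ {j p u w} → OnRoute j p u → OnRoute j p w → u ≡ w) →
    ∀ {j p b q u w xs} → Follows OnRoute j p xs → TempFrom H b xs → OnRoute j q u → OnRoute j (suc q) w →
    p ≤ q → suc q < p + length xs → Σ ℕ λ l → lab H u w ≡ just l
  followed-step-is-edge H deterministic {p = p} [ _ ] _ _ _ p≤q 1+q<p+1 =
    contradiction p≤q (<⇒≱ (s≤s⁻¹ (≤-trans 1+q<p+1 (≤-reflexive (+-comm p 1)))))
  followed-step-is-edge H deterministic {p = p} {q = q} (x-at-p ∷ ys) (l , xy , _ , temp) u-at-q w-at-1+q p≤q bound
    with m≤n⇒m<n∨m≡n p≤q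
  ... | inj₂ refl rewrite deterministic u-at-q x-at-p | deterministic w-at-1+q (follows-head ys) = l , xy
  ... | inj₁ p<q = followed-step-is-edge H deterministic ys temp u-at-q w-at-1+q p<q
                     (≤-trans bound (≤-reflexive (+-suc p _)))

-- The construction

module Construction (k₀ : ℕ) where

  k lastRound rounds routeLength : ℕ
  k           = suc k₀
  lastRound   = k₀ + k
  rounds      = suc lastRound
  routeLength = suc (rounds * 4)

  IsLabel : ℕ → Set
  IsLabel j = 1 ≤ j × j ≤ k

  isLabel? : ∀ j → Dec (IsLabel j)
  isLabel? j = 1 ≤? j ×-dec j ≤? k

  data Layer : Set where
    A B C D : Layer

  offset weight : Layer → ℕ
  offset A = 0
  offset B = 1
  offset C = 2
  offset D = 3
  weight A = 1
  weight B = 2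
  weight C = 3
  weight D = 2

  layerAt : ℕ → Layer
  layerAt 0 = A
  layerAt 1 = B
  layerAt 2 = C
  layerAt _ = D

  layerAt-offset : ∀ X → layerAt (offset X) ≡ X
  layerAt-offset A = refl
  layerAt-offset B = refl
  layerAt-offset C = refl
  layerAt-offset D = refl

  offset-injective : ∀ {X Y} → offset X ≡ offset Y → X ≡ Y
  offset-injective {X} {Y} eq = trans (sym (layerAt-offset X)) (trans (cong layerAt eq) (layerAt-offset Y))

  offset<4 : ∀ X → offset X < 4
  offset<4 A = s≤s z≤n
  offset<4 B = s≤s (s≤s z≤n)
  offset<4 C = s≤s (s≤s (s≤s z≤n))
  offset<4 D = ≤-refl

  weight-nonZero : ∀ X → NonZero (weight X)
  weight-nonZero A = _
  weight-nonZero B = _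
  weight-nonZero C = _
  weight-nonZero D = _

  weight≤3 : ∀ X → weight X ≤ 3
  weight≤3 A = s≤s z≤n
  weight≤3 B = s≤s (s≤s z≤n)
  weight≤3 C = ≤-refl
  weight≤3 D = s≤s (s≤s z≤n)

  data Vertex : Set where
    source padding : Vertex
    node           : Layer → ℕ → Vertex
    target         : ℕ → Vertex

  data Visits (j : ℕ) : ℕ → Vertex → Set where
    source : Visits j 0 source
    node   : ∀ {p i} X r → r ≤ lastRound → p ≡ suc (offset X + r * 4) → i ≡ weight X * j + r → Visits j p (node X i)
    target : ∀ {p i} → p ≡ routeLength → i ≡ j → Visits j p (target i)

  round-position-injective : ∀ X Y r r′ → offset X + r * 4 ≡ offset Y + r′ * 4 → X ≡ Y × r ≡ r′
  round-position-injective X Y r r′ eq =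
    X≡Y , *-cancelʳ-≡ r r′ 4 (+-cancelˡ-≡ (offset X) _ _ (trans eq (cong (_+ r′ * 4) (sym oX≡oY))))
    where
    layer-of : ∀ Z s → (offset Z + s * 4) % 4 ≡ offset Z
    layer-of Z s = trans ([m+kn]%n≡m%n (offset Z) s 4) (m<n⇒m%n≡m (offset<4 Z))
    oX≡oY : offset X ≡ offset Y
    oX≡oY = trans (sym (layer-of X r)) (trans (cong (_% 4) eq) (layer-of Y r′))
    X≡Y : X ≡ Y
    X≡Y = offset-injective oX≡oY

  round-position<routeLength : ∀ X {r} → r ≤ lastRound → suc (offset X + r * 4) < routeLength
  round-position<routeLength X {r} r≤ = s≤s (begin-strict
    offset X + r * 4 <⟨ +-monoˡ-< (r * 4) (offset<4 X) ⟩
    suc r * 4        ≤⟨ *-monoˡ-≤ 4 (s≤s r≤) ⟩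
    rounds * 4       ∎)
    where open ≤-Reasoning

  visits-≤ : ∀ {j p v} → Visits j p v → p ≤ routeLength
  visits-≤ source                 = z≤n
  visits-≤ (node X _ r≤ refl _)   = <⇒≤ (round-position<routeLength X r≤)
  visits-≤ (target refl _)        = ≤-refl

  later-route-earlier : ∀ {b l p q v} → Visits b p v → Visits l q v → b ≤ l → q ≤ p
  later-route-earlier source                    source                    _   = z≤n
  later-route-earlier (node X r _ refl refl)    (node X r′ _ refl eq)     b≤l =
    s≤s (+-monoʳ-≤ (offset X) (*-monoˡ-≤ 4 (weighted-cancel-≤ (weight X) eq b≤l)))
  later-route-earlier (target refl _)           (target refl _)           _   = ≤-refl

  later-route-strictly-earlier : ∀ {b l p q v} → Visits b p v → Visits l q v → b < l → 1 ≤ p → q < p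
  later-route-strictly-earlier (node X r _ refl refl) (node X r′ _ refl eq) b<l _ =
    s≤s (+-monoʳ-< (offset X) (*-monoˡ-< 4 (weighted-cancel-< (weight X) {{weight-nonZero X}} eq b<l)))
  later-route-strictly-earlier (target _ refl) (target _ refl) b<l _ = contradiction refl (<⇒≢ b<l)

  visits-deterministic : ∀ {j p v w} → Visits j p v → Visits j p w → v ≡ w
  visits-deterministic source source = refl
  visits-deterministic (node X r _ refl refl) (node Y r′ _ eq refl) with round-position-injective X Y r r′ (suc-injective eq)
  ... | refl , refl = refl
  visits-deterministic (node X _ r≤ refl _) (target eq _) = contradiction eq (<⇒≢ (round-position<routeLength X r≤))
  visits-deterministic (target eq _) (node X _ r≤ refl _) = contradiction eq (<⇒≢ (round-position<routeLength X r≤))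
  visits-deterministic (target _ refl) (target _ refl) = refl

  visits-not-padding : ∀ {j p v} → Visits j p v → v ≢ padding
  visits-not-padding source             ()
  visits-not-padding (node _ _ _ _ _)   ()
  visits-not-padding (target _ _)       ()

  labelIf : {P : Set} → Dec P → ℕ → Maybe ℕ
  labelIf (yes _) j = just j
  labelIf (no _)  _ = nothing

  labelIf-just : {P : Set} (d : Dec P) {j l : ℕ} → labelIf d j ≡ just l → P × j ≡ l
  labelIf-just (yes p) refl = p , refl

  labelIf-yes : {P : Set} (d : Dec P) {j : ℕ} → P → labelIf d j ≡ just j
  labelIf-yes (yes _) _ = refl
  labelIf-yes (no ¬p) p = contradiction p ¬p

  -- Step X Y δ: after a node of layer X a route visits a node of layer Y, δ rounds later.
  data Step : Layer → Layer → ℕ → Set where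
    A→B : Step A B 0
    B→C : Step B C 0
    C→D : Step C D 0
    D→A : Step D A 1

  step-position : ∀ {X Y δ} → Step X Y δ → ∀ r → suc (suc (offset X + r * 4)) ≡ suc (offset Y + (δ + r) * 4)
  step-position A→B r = refl
  step-position B→C r = refl
  step-position C→D r = refl
  step-position D→A r = refl

  -- The only label for which node X i and node Y m can be consecutive on a route.
  stepLabel : ∀ {X Y δ} → Step X Y δ → ℕ → ℕ → ℕ
  stepLabel A→B i m = m ∸ i
  stepLabel B→C i m = m ∸ i
  stepLabel C→D i m = i ∸ m
  stepLabel D→A i m = suc i ∸ m

  stepLabel-correct : ∀ {X Y δ} (s : Step X Y δ) j r → stepLabel s (weight X * j + r) (weight Y * j + (δ + r)) ≡ j
  stepLabel-correct A→B j r = m≡n+o⇒m∸o≡n (solve 2 (λ j r → con 2 :* j :+ r := j :+ (con 1 :* j :+ r)) refl j r)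
  stepLabel-correct B→C j r = m≡n+o⇒m∸o≡n (solve 2 (λ j r → con 3 :* j :+ r := j :+ (con 2 :* j :+ r)) refl j r)
  stepLabel-correct C→D j r = m≡n+o⇒m∸o≡n (solve 2 (λ j r → con 3 :* j :+ r := j :+ (con 2 :* j :+ r)) refl j r)
  stepLabel-correct D→A j r =
    m≡n+o⇒m∸o≡n (solve 2 (λ j r → con 1 :+ (con 2 :* j :+ r) := j :+ (con 1 :* j :+ (con 1 :+ r))) refl j r)

  -- With r = i ∸ weight X * j: node X i is in round r of route j, and node Y m in round δ + r.
  StepValid : Layer → Layer → ℕ → (j i m : ℕ) → Set
  StepValid X Y δ j i m =
    IsLabel j × weight X * j ≤ i × m ≡ weight Y * j + (δ + (i ∸ weight X * j)) × δ + (i ∸ weight X * j) ≤ lastRound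

  stepValid? : ∀ X Y δ j i m → Dec (StepValid X Y δ j i m)
  stepValid? X Y δ j i m = isLabel? j ×-dec weight X * j ≤? i ×-dec m ≟ _ ×-dec _ ≤? lastRound

  data Arc : Vertex → Vertex → Set where
    start  : ∀ i → Arc source (node A i)
    step   : ∀ {X Y δ} → Step X Y δ → ∀ i m → Arc (node X i) (node Y m)
    finish : ∀ i j → Arc (node D i) (target j)

  arc? : ∀ u w → Maybe (Arc u w)
  arc? source     (node A i) = just (start i)
  arc? (node A i) (node B m) = just (step A→B i m)
  arc? (node B i) (node C m) = just (step B→C i m)
  arc? (node C i) (node D m) = just (step C→D i m)
  arc? (node D i) (node A m) = just (step D→A i m)
  arc? (node D i) (target j) = just (finish i j)
  arc? _          _          = nothing

  arcLabel : ∀ {u w} → Arc u w → Maybe ℕ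
  arcLabel (start i)                  = labelIf (isLabel? i) i
  arcLabel (step {X} {Y} {δ} s i m)   = labelIf (stepValid? X Y δ (stepLabel s i m) i m) (stepLabel s i m)
  arcLabel (finish i j)               = labelIf (isLabel? j ×-dec i ≟ weight D * j + lastRound) j

  arc label : Vertex → Vertex → Maybe ℕ
  arc u w   = arc? u w >>= arcLabel
  label u w = arc u w <∣> arc w u

  arc?-reverse : ∀ {u w} → Arc u w → arc? w u ≡ nothing
  arc?-reverse (start _)        = refl
  arc?-reverse (step A→B _ _)   = refl
  arc?-reverse (step B→C _ _)   = refl
  arc?-reverse (step C→D _ _)   = refl
  arc?-reverse (step D→A _ _)   = refl
  arc?-reverse (finish _ _)     = refl

  arc?-irreflexive : ∀ v → arc? v v ≡ nothing
  arc?-irreflexive source       = refl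
  arc?-irreflexive padding      = refl
  arc?-irreflexive (node A _)   = refl
  arc?-irreflexive (node B _)   = refl
  arc?-irreflexive (node C _)   = refl
  arc?-irreflexive (node D _)   = refl
  arc?-irreflexive (target _)   = refl

  arc-asymmetric : ∀ u w → arc u w ≡ nothing ⊎ arc w u ≡ nothing
  arc-asymmetric u w with arc? u w
  ... | nothing = inj₁ refl
  ... | just a  = inj₂ (cong (_>>= arcLabel) (arc?-reverse a))

  label-symmetric : ∀ u w → label u w ≡ label w u
  label-symmetric u w with arc-asymmetric u w
  ... | inj₁ uw≡nothing rewrite uw≡nothing = sym (<∣>-identityʳ _)
  ... | inj₂ wu≡nothing rewrite wu≡nothing = <∣>-identityʳ _

  label-irreflexive : ∀ v → label v v ≡ nothing
  label-irreflexive v rewrite arc?-irreflexive v = refl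

  RouteStep : ℕ → Vertex → Vertex → Set
  RouteStep l u w = IsLabel l × Σ ℕ λ q → Visits l q u × Visits l (suc q) w

  arcLabel-sound : ∀ {u w l} (a : Arc u w) → arcLabel a ≡ just l → RouteStep l u w
  arcLabel-sound (start i) eq with labelIf-just (isLabel? i) eq
  ... | ℓ , refl = ℓ , 0 , source , node A 0 z≤n refl (sym (trans (+-identityʳ _) (+-identityʳ i)))
  arcLabel-sound (step {X} {Y} {δ} s i m) eq with labelIf-just (stepValid? X Y δ _ i m) eq
  ... | (ℓ , wj≤i , m≡ , last≤) , refl =
    ℓ , _ , node X r (≤-trans (m≤n+m r δ) last≤) refl (sym (m+[n∸m]≡n wj≤i)) ,
            node Y (δ + r) last≤ (step-position s r) m≡
    where
    r : ℕ
    r = i ∸ weight X * stepLabel s i m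
  arcLabel-sound (finish i j) eq with labelIf-just (isLabel? j ×-dec i ≟ weight D * j + lastRound) eq
  ... | (ℓ , i≡) , refl = ℓ , _ , node D lastRound ≤-refl refl i≡ , target refl refl

  arc-sound : ∀ u w {l} → arc u w ≡ just l → RouteStep l u w
  arc-sound u w eq with arc? u w
  ... | just a = arcLabel-sound a eq

  label-sound : ∀ u w {l} → label u w ≡ just l → RouteStep l u w ⊎ RouteStep l w u
  label-sound u w eq with arc u w in uw
  ... | just _  with refl ← eq = inj₁ (arc-sound u w uw)
  ... | nothing = inj₂ (arc-sound w u eq)

  label-from-arc : ∀ u w {l} → arc u w ≡ just l → label u w ≡ just l
  label-from-arc u w uw rewrite uw = refl

  arc-step : ∀ {X Y δ} (s : Step X Y δ) i m → arc (node X i) (node Y m) ≡ arcLabel (step s i m)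
  arc-step A→B i m = refl
  arc-step B→C i m = refl
  arc-step C→D i m = refl
  arc-step D→A i m = refl

  start-label : ∀ {j} → IsLabel j → label source (node A (weight A * j + 0)) ≡ just j
  start-label {j} ℓ = label-from-arc source (node A (weight A * j + 0))
    (trans (cong (λ i → labelIf (isLabel? i) i) (trans (+-identityʳ (j + 0)) (+-identityʳ j))) (labelIf-yes (isLabel? j) ℓ))

  step-label : ∀ {X Y δ} (s : Step X Y δ) {j r} → IsLabel j → δ + r ≤ lastRound →
               label (node X (weight X * j + r)) (node Y (weight Y * j + (δ + r))) ≡ just j
  step-label {X} {Y} {δ} s {j} {r} ℓ last≤ = label-from-arc (node X i) (node Y m) (begin
    arc (node X i) (node Y m)                                           ≡⟨ arc-step s i m ⟩
    labelIf (stepValid? X Y δ (stepLabel s i m) i m) (stepLabel s i m)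
      ≡⟨ cong (λ c → labelIf (stepValid? X Y δ c i m) c) (stepLabel-correct s j r) ⟩
    labelIf (stepValid? X Y δ j i m) j                                  ≡⟨ labelIf-yes (stepValid? X Y δ j i m) valid ⟩
    just j                                                              ∎)
    where
    open ≡-Reasoning
    i m : ℕ
    i = weight X * j + r
    m = weight Y * j + (δ + r)
    valid : StepValid X Y δ j i m
    valid rewrite m+n∸m≡n (weight X * j) r = ℓ , m≤m+n _ r , refl , last≤

  finish-label : ∀ {j r} → IsLabel j → r ≡ lastRound → label (node D (weight D * j + r)) (target j) ≡ just j
  finish-label {j} ℓ refl = label-from-arc (node D _) (target j) (labelIf-yes (isLabel? j ×-dec _ ≟ _) (ℓ , refl))

  roundNodes : ℕ → ℕ → List Vertex
  roundNodes j r =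
    node A (weight A * j + r) ∷ node B (weight B * j + r) ∷ node C (weight C * j + r) ∷ node D (weight D * j + r) ∷ []

  roundsFrom afterRound : (j r m : ℕ) → List Vertex
  roundsFrom j r m = roundNodes j r ++ afterRound j r m
  afterRound j r zero    = target j ∷ []
  afterRound j r (suc m) = roundsFrom j (suc r) m

  route : ℕ → List Vertex
  route j = source ∷ roundsFrom j 0 lastRound

  round≤last : ∀ {r m} → r + m ≡ lastRound → r ≤ lastRound
  round≤last {r} {m} r+m≡ = ≤-trans (m≤m+n r m) (≤-reflexive r+m≡)

  last-round : ∀ {r} → r + 0 ≡ lastRound → r ≡ lastRound
  last-round {r} = trans (sym (+-identityʳ r))

  next-round : ∀ {r m} → r + suc m ≡ lastRound → suc r + m ≡ lastRound
  next-round {r} {m} = trans (sym (+-suc r m))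

  rounds-linked : ∀ {j} → IsLabel j → ∀ r m → r + m ≡ lastRound →
                  Linked (λ u w → label u w ≡ just j) (roundsFrom j r m)
  rounds-linked ℓ r zero r+0≡ =
    step-label A→B ℓ (round≤last r+0≡) ∷ step-label B→C ℓ (round≤last r+0≡) ∷ step-label C→D ℓ (round≤last r+0≡) ∷
    finish-label ℓ (last-round r+0≡) ∷ [-]
  rounds-linked ℓ r (suc m) r+1+m≡ =
    step-label A→B ℓ (round≤last r+1+m≡) ∷ step-label B→C ℓ (round≤last r+1+m≡) ∷ step-label C→D ℓ (round≤last r+1+m≡) ∷
    step-label D→A ℓ (round≤last (next-round r+1+m≡)) ∷ rounds-linked ℓ (suc r) m (next-round r+1+m≡)

  route-linked : ∀ {j} → IsLabel j → Linked (λ u w → label u w ≡ just j) (route j)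
  route-linked ℓ = start-label ℓ ∷ rounds-linked ℓ 0 lastRound refl

  rounds-follow : ∀ j r m → r + m ≡ lastRound → Follows Visits j (suc (r * 4)) (roundsFrom j r m)
  rounds-follow j r zero r+0≡ =
    node A r r≤ refl refl ∷ node B r r≤ refl refl ∷ node C r r≤ refl refl ∷ node D r r≤ refl refl ∷
    [ target (cong (λ r → suc (suc r * 4)) (last-round r+0≡)) refl ]
    where
    r≤ : r ≤ lastRound
    r≤ = round≤last r+0≡
  rounds-follow j r (suc m) r+1+m≡ =
    node A r r≤ refl refl ∷ node B r r≤ refl refl ∷ node C r r≤ refl refl ∷ node D r r≤ refl refl ∷
    rounds-follow j (suc r) m (next-round r+1+m≡)
    where
    r≤ : r ≤ lastRound
    r≤ = round≤last r+1+m≡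

  route-follows : ∀ j → Follows Visits j 0 (route j)
  route-follows j = source ∷ rounds-follow j 0 lastRound refl

  rounds-length : ∀ j r m → length (roundsFrom j r m) ≡ suc (suc m * 4)
  rounds-length j r zero    = refl
  rounds-length j r (suc m) = cong (4 +_) (rounds-length j (suc r) m)

  rounds-end : ∀ {n} (f : Vertex → Fin n) j r m u → end u (map f (roundsFrom j r m)) ≡ f (target j)
  rounds-end f j r zero    u = refl
  rounds-end f j r (suc m) u = rounds-end f j (suc r) m (f (node D (weight D * j + r)))

  blockSize vertexCount : ℕ
  blockSize   = 5 * k
  vertexCount = suc (5 * blockSize)

  instance
    blockSize-nonZero : NonZero blockSize
    blockSize-nonZero = m*n≢0 5 k

  Small : Vertex → Set
  Small source     = ⊤
  Small padding    = ⊥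
  Small (node _ i) = i < blockSize
  Small (target j) = j < blockSize

  3k+lastRound<blockSize : 3 * k + lastRound < blockSize
  3k+lastRound<blockSize =
    ≤-reflexive (solve 1 (λ z → con 1 :+ (con 3 :* (con 1 :+ z) :+ (z :+ (con 1 :+ z))) := con 5 :* (con 1 :+ z)) refl k₀)

  visits-small : ∀ {j p v} → IsLabel j → Visits j p v → Small v
  visits-small _         source               = tt
  visits-small (_ , j≤k) (node X r r≤ _ refl) =
    ≤-<-trans (+-mono-≤ (*-mono-≤ (weight≤3 X) j≤k) r≤) 3k+lastRound<blockSize
  visits-small (_ , j≤k) (target _ refl)      =
    ≤-<-trans (≤-trans j≤k (≤-trans (m≤n*m k 3) (m≤m+n (3 * k) lastRound))) 3k+lastRound<blockSize

  -- Code 0 is the source, followed by a block of blockSize codes for each of the layers A, B, C, D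
  -- and the targets; all larger codes decode to padding, whose own code 0 is never used.
  enc : Vertex → ℕ
  enc source     = 0
  enc padding    = 0
  enc (node X i) = suc (offset X * blockSize + i)
  enc (target j) = suc (4 * blockSize + j)

  block : ℕ → ℕ → Vertex
  block 0 i = node A i
  block 1 i = node B i
  block 2 i = node C i
  block 3 i = node D i
  block 4 i = target i
  block _ _ = padding

  dec : ℕ → Vertex
  dec zero    = source
  dec (suc w) = block (w / blockSize) (w % blockSize)

  block-offset : ∀ X i → block (offset X) i ≡ node X i
  block-offset A i = refl
  block-offset B i = refl
  block-offset C i = refl
  block-offset D i = refl

  dec-block : ∀ q {i} → i < blockSize → dec (suc (q * blockSize + i)) ≡ block q i
  dec-block q {i} i< = cong₂ block quotient remainder
    where
    quotient : (q * blockSize + i) / blockSize ≡ q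
    quotient = trans (+-distrib-/-∣ˡ i (divides-refl q))
                     (trans (cong₂ _+_ (m*n/n≡m q blockSize) (m<n⇒m/n≡0 i<)) (+-identityʳ q))
    remainder : (q * blockSize + i) % blockSize ≡ i
    remainder = trans (cong (_% blockSize) (+-comm (q * blockSize) i))
                      (trans ([m+kn]%n≡m%n i q blockSize) (m<n⇒m%n≡m i<))

  dec-enc : ∀ {v} → Small v → dec (enc v) ≡ v
  dec-enc {source}   _  = refl
  dec-enc {node X i} i< = trans (dec-block (offset X) i<) (block-offset X i)
  dec-enc {target j} j< = dec-block 4 j<

  enc-block : ∀ q i → block q i ≢ padding → enc (block q i) ≡ suc (q * blockSize + i)
  enc-block 0 i _ = refl
  enc-block 1 i _ = refl
  enc-block 2 i _ = refl
  enc-block 3 i _ = refl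
  enc-block 4 i _ = refl
  enc-block (suc (suc (suc (suc (suc _))))) i ¬padding = contradiction refl ¬padding

  enc-dec : ∀ w → dec w ≢ padding → enc (dec w) ≡ w
  enc-dec zero    _        = refl
  enc-dec (suc w) ¬padding = trans (enc-block (w / blockSize) (w % blockSize) ¬padding)
    (cong suc (trans (+-comm _ (w % blockSize)) (sym (m≡m%n+[m/n]*n w blockSize))))

  enc<vertexCount : ∀ {v} → Small v → enc v < vertexCount
  enc<vertexCount {source}   _  = s≤s z≤n
  enc<vertexCount {node X i} i< = s≤s (begin-strict
    offset X * blockSize + i          <⟨ +-monoʳ-< (offset X * blockSize) i< ⟩
    offset X * blockSize + blockSize  ≡⟨ +-comm _ blockSize ⟩
    suc (offset X) * blockSize        ≤⟨ *-monoˡ-≤ blockSize (≤-trans (offset<4 X) (n≤1+n 4)) ⟩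
    5 * blockSize                     ∎)
    where open ≤-Reasoning
  enc<vertexCount {target j} j< = s≤s (≤-trans (+-monoʳ-< (4 * blockSize) j<) (≤-reflexive (+-comm _ blockSize)))

  3k≤blockSize : k + k + k ≤ blockSize
  3k≤blockSize =
    ≤-trans (m≤m+n (k + k + k) (k + k)) (≤-reflexive (solve 1 (λ k → k :+ k :+ k :+ (k :+ k) := con 5 :* k) refl k))

  2blockSize≤5blockSize : 1 * blockSize + blockSize ≤ 5 * blockSize
  2blockSize≤5blockSize = ≤-trans (≤-reflexive (+-comm (1 * blockSize) blockSize)) (*-monoˡ-≤ blockSize (s≤s (s≤s (z≤n {3}))))

  column : ℕ → ℕ
  column t = enc (node B (k + t + 1))

  module Graph (n : ℕ) (vertexCount≤n : vertexCount ≤ n) where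

    instance
      n-nonZero : NonZero n
      n-nonZero = >-nonZero (≤-trans (s≤s z≤n) vertexCount≤n)

    encode : Vertex → Fin n
    encode v = enc v mod n

    decode : Fin n → Vertex
    decode x = dec (toℕ x)

    toℕ-encode : ∀ {v} → Small v → toℕ (encode v) ≡ enc v
    toℕ-encode small = trans (toℕ-fromℕ< _) (m<n⇒m%n≡m (≤-trans (enc<vertexCount small) vertexCount≤n))

    decode-encode : ∀ {v} → Small v → decode (encode v) ≡ v
    decode-encode small = trans (cong dec (toℕ-encode small)) (dec-enc small)

    toℕ≡enc⇒≡encode : ∀ v {x} → Small v → toℕ x ≡ enc v → x ≡ encode v
    toℕ≡enc⇒≡encode v small x≡ = toℕ-injective (trans x≡ (sym (toℕ-encode small)))

    decode-injective : ∀ {x y} → decode x ≡ decode y → decode x ≢ padding → x ≡ y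
    decode-injective {x} {y} x≡y ¬padding = toℕ-injective (begin
      toℕ x              ≡⟨ enc-dec (toℕ x) ¬padding ⟨
      enc (decode x)     ≡⟨ cong enc x≡y ⟩
      enc (decode y)     ≡⟨ enc-dec (toℕ y) (λ y≡padding → ¬padding (trans x≡y y≡padding)) ⟩
      toℕ y              ∎)
      where open ≡-Reasoning

    G : TGraph n
    G = record
      { lab    = λ x y → label (decode x) (decode y)
      ; sym    = λ x y → label-symmetric (decode x) (decode y)
      ; irrefl = λ x → label-irreflexive (decode x)
      ; pos    = λ x y l xy → proj₁ ([ proj₁ , proj₁ ]′ (label-sound (decode x) (decode y) xy))
      }

    OnRoute : ℕ → ℕ → Fin n → Set
    OnRoute j p x = Visits j p (decode x)

    edge-on-route : ∀ x y {l} → lab G x y ≡ just l → Σ ℕ λ q →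
                    (OnRoute l q x × OnRoute l (suc q) y) ⊎ (OnRoute l q y × OnRoute l (suc q) x)
    edge-on-route x y xy with label-sound (decode x) (decode y) xy
    ... | inj₁ (_ , q , x-at-q , y-at-1+q) = q , inj₁ (x-at-q , y-at-1+q)
    ... | inj₂ (_ , q , y-at-q , x-at-1+q) = q , inj₂ (y-at-q , x-at-1+q)

    open Routes G OnRoute edge-on-route later-route-earlier later-route-strictly-earlier

    onRoute-deterministic : ∀ {j p x y} → OnRoute j p x → OnRoute j p y → x ≡ y
    onRoute-deterministic x-at-p y-at-p = decode-injective (visits-deterministic x-at-p y-at-p) (visits-not-padding x-at-p)

    visits-encode : ∀ {j p v} → IsLabel j → Visits j p v → OnRoute j p (encode v)
    visits-encode ℓ v-at-p = subst (Visits _ _) (sym (decode-encode (visits-small ℓ v-at-p))) v-at-p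

    lab-encode : ∀ {u w l} → label u w ≡ just l → lab G (encode u) (encode w) ≡ just l
    lab-encode {u} {w} uw with label-sound u w uw
    ... | inj₁ (ℓ , _ , u-at , w-at)
      rewrite decode-encode (visits-small ℓ u-at) | decode-encode (visits-small ℓ w-at) = uw
    ... | inj₂ (ℓ , _ , w-at , u-at)
      rewrite decode-encode (visits-small ℓ u-at) | decode-encode (visits-small ℓ w-at) = uw

    s : Fin n
    s = encode source

    terminal : ℕ → Fin n
    terminal j = encode (target j)

    source-at-start : OnRoute 0 0 s
    source-at-start = subst (Visits 0 0) (sym (decode-encode {source} tt)) source

    terminal-only-at-end : ∀ {j} → IsLabel j → ∀ {b p} → OnRoute b p (terminal j) → b ≡ j × p ≡ routeLength
    terminal-only-at-end {j} ℓ {b} {p} on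
      with subst (Visits b p) (decode-encode {target j} (visits-small ℓ (target {p = routeLength} refl refl))) on
    ... | target p≡ refl = refl , p≡

    route-path : ∀ {j} → IsLabel j → TPath G s (terminal j) routeLength
    route-path {j} ℓ = record
      { rest   = map encode (roundsFrom j 0 lastRound)
      ; len    = trans (length-map encode (roundsFrom j 0 lastRound)) (rounds-length j 0 lastRound)
      ; ends   = rounds-end encode j 0 lastRound s
      ; simple = follows-unique (follows-map encode (visits-encode ℓ) (route-follows j))
      ; temp   = temp-linked G (Linked.map⁺ (Linked.map lab-encode (route-linked ℓ))) z≤n
      }

    route-path-shortest : ∀ {j m} → IsLabel j → TPath G s (terminal j) m → routeLength ≤ m
    route-path-shortest ℓ record { rest = rest ; len = refl ; ends = ends ; temp = temp }
      with walk-bound rest temp source-at-start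
    ... | _ , _ , end-at , p′≤ with terminal-only-at-end ℓ (subst (OnRoute _ _) ends end-at)
    ...   | _ , refl = p′≤

    route-distance : ∀ {j} → IsLabel j → IsDist G s (terminal j) (just routeLength)
    route-distance ℓ = finite _ (route-path ℓ) (λ _ → route-path-shortest ℓ)

    ≤vertexCount : ∀ {m} → m ≤ 1 * blockSize + blockSize → suc m ≤ n
    ≤vertexCount m≤ = ≤-trans (s≤s (≤-trans m≤ 2blockSize≤5blockSize)) vertexCount≤n

    rows≤n : suc k + k ≤ n
    rows≤n = ≤vertexCount (≤-trans (≤-trans (m≤m+n (k + k) k) 3k≤blockSize) (m≤n+m blockSize (1 * blockSize)))

    columns≤n : ∀ t → t < k → column t + k ≤ n
    columns≤n t t<k = ≤vertexCount (begin
      1 * blockSize + (k + t + 1) + k  ≡⟨ +-assoc (1 * blockSize) _ k ⟩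
      1 * blockSize + (k + t + 1 + k)  ≤⟨ +-monoʳ-≤ (1 * blockSize) (+-monoˡ-≤ k k+t+1≤k+k) ⟩
      1 * blockSize + (k + k + k)      ≤⟨ +-monoʳ-≤ (1 * blockSize) 3k≤blockSize ⟩
      1 * blockSize + blockSize        ∎)
      where
      open ≤-Reasoning
      k+t+1≤k+k : k + t + 1 ≤ k + k
      k+t+1≤k+k = ≤-trans (≤-reflexive (+-assoc k t 1)) (+-monoʳ-≤ k (≤-trans (≤-reflexive (+-comm t 1)) t<k))

    module _ (H : TGraph n) (sub : IsTSubgraph H G) (preserves : IsPreserver G H s) where

      route-edge-preserved : ∀ {j q u w} → IsLabel j → Visits j q u → Visits j (suc q) w →
                             Σ ℕ λ l → lab H (encode u) (encode w) ≡ just l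
      route-edge-preserved {j} ℓ u-at w-at with preserves (terminal j) _ (route-distance ℓ)
      ... | finite _ record { rest = rest ; len = len ; ends = ends ; temp = temp } _ =
        followed-step-is-edge H onRoute-deterministic follows temp (visits-encode ℓ u-at) (visits-encode ℓ w-at) z≤n
                     (s≤s (≤-trans (visits-≤ w-at) (≤-reflexive (sym len))))
        where
        follows : Follows OnRoute j 0 (s ∷ rest)
        follows = shortest-walk-follows (terminal-only-at-end ℓ) rest (temp-subgraph sub (s ∷ rest) temp) source-at-start ends len

      forced-edge : ∀ i j → k ≤ i → i < k + k → IsLabel j →
                    Σ ℕ λ l → lab H (encode (node A i)) (encode (node B (i + j))) ≡ just l
      forced-edge i j k≤i i<2k ℓ@(1≤j , j≤k) = route-edge-preserved ℓ (node A r r≤ refl i≡) (node B r r≤ refl i+j≡)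
        where
        r : ℕ
        r = i ∸ j
        j+r≡i : j + r ≡ i
        j+r≡i = m+[n∸m]≡n (≤-trans j≤k k≤i)
        i≡ : i ≡ weight A * j + r
        i≡ = trans (sym j+r≡i) (cong (_+ r) (sym (*-identityˡ j)))
        i+j≡ : i + j ≡ weight B * j + r
        i+j≡ = trans (cong (_+ j) (sym j+r≡i)) (solve 2 (λ j r → j :+ r :+ j := con 2 :* j :+ r) refl j r)
        r≤ : r ≤ lastRound
        r≤ = <⇒≤ (≤-trans (+-monoˡ-≤ r 1≤j) (≤-trans (≤-reflexive j+r≡i) (s≤s⁻¹ i<2k)))

      forced-grid-edge : ∀ t u → t < k → u < k → ∀ x y → toℕ x ≡ suc k + t → toℕ y ≡ column t + u →
                         toℕ x < toℕ y × Σ ℕ λ l → lab H x y ≡ just l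
      forced-grid-edge t u t<k u<k x y x≡ y≡ =
        x<y , subst₂ (λ x y → Σ ℕ λ l → lab H x y ≡ just l) (sym x≡encode) (sym y≡encode)
                     (forced-edge (k + t) (suc u) (m≤m+n k t) (+-monoʳ-< k t<k) (s≤s z≤n , u<k))
        where
        x≡encode : x ≡ encode (node A (k + t))
        x≡encode = toℕ≡enc⇒≡encode (node A (k + t))
          (<-≤-trans (+-monoʳ-< k t<k) (≤-trans (m≤m+n (k + k) k) 3k≤blockSize)) x≡
        y≡encode : y ≡ encode (node B (k + t + suc u))
        y≡encode = toℕ≡enc⇒≡encode (node B (k + t + suc u)) (<-≤-trans (+-mono-<-≤ (+-monoʳ-< k t<k) u<k) 3k≤blockSize)
          (trans y≡ (cong suc (solve 4 (λ b k t u → b :+ (k :+ t :+ con 1) :+ u := b :+ (k :+ t :+ (con 1 :+ u)))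
                                      refl (1 * blockSize) k t u)))
        x<y : toℕ x < toℕ y
        x<y = begin-strict
          toℕ x                        ≡⟨ x≡ ⟩
          suc (k + t)                  ≡⟨ +-comm 1 (k + t) ⟩
          k + t + 1                    ≤⟨ m≤n+m _ (1 * blockSize) ⟩
          1 * blockSize + (k + t + 1)  <⟨ n<1+n _ ⟩
          column t                     ≤⟨ m≤m+n (column t) u ⟩
          column t + u                 ≡⟨ y≡ ⟨
          toℕ y                        ∎
          where open ≤-Reasoning

      k*k≤size : k * k ≤ size H
      k*k≤size = size-≥ H (suc k) k column k rows≤n columns≤n forced-grid-edge

  vertexCount≤26k : vertexCount ≤ 26 * k
  vertexCount≤26k = ≤-trans (+-monoˡ-≤ (5 * blockSize) (s≤s (z≤n {k₀})))
                            (≤-reflexive (solve 1 (λ k → k :+ con 5 :* (con 5 :* k) := con 26 :* k) refl k))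

26k≤n≤52k : ∀ n → 26 ≤ n → Σ ℕ λ k₀ → 26 * suc k₀ ≤ n × n ≤ 52 * suc k₀
26k≤n≤52k n 26≤n with n / 26 | m≥n⇒m/n>0 {n} {26} 26≤n | m/n*n≤m n 26 | m≡m%n+[m/n]*n n 26 | m%n<n n 26
... | suc k₀ | _ | q*26≤n | n≡ | r<26 = k₀ , ≤-trans (≤-reflexive (*-comm 26 (suc k₀))) q*26≤n , (begin
  n                          ≡⟨ n≡ ⟩
  n % 26 + suc k₀ * 26       ≤⟨ +-monoˡ-≤ (suc k₀ * 26) (≤-trans (<⇒≤ r<26) (m≤m+n 26 (k₀ * 26))) ⟩
  suc k₀ * 26 + suc k₀ * 26  ≡⟨ solve 1 (λ k → k :* con 26 :+ k :* con 26 := con 52 :* k) refl (suc k₀) ⟩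
  52 * suc k₀                ∎)
  where open ≤-Reasoning

preserver-has-k²-edges : ∀ k₀ n → 26 * suc k₀ ≤ n →
  Σ (TGraph n) λ G → Σ (Fin n) λ s → ∀ H → IsTSubgraph H G → IsPreserver G H s → suc k₀ * suc k₀ ≤ size H
preserver-has-k²-edges k₀ n 26k≤n = G , s , k*k≤size
  where
  open Construction k₀
  open Graph n (≤-trans vertexCount≤26k 26k≤n)

mainTheorem7 : Σ ℕ λ c₁ → Σ ℕ λ c₂ → Σ ℕ λ n₀ →
    ∀ (n : ℕ) → n₀ ≤ n →
    Σ (TGraph n) λ G → Σ (Fin n) λ s →
      ∀ (H : TGraph n) → IsTSubgraph H G → IsPreserver G H s →
        (n * n ≤ c₁ * size H) × (size H ≤ c₂ * (n * n))
mainTheorem7 = 2704 , 1 , 26 , λ n 26≤n →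
  let k₀ , 26k≤n , n≤52k = 26k≤n≤52k n 26≤n
      G , s , k²≤size   = preserver-has-k²-edges k₀ n 26k≤n
      k = suc k₀
  in G , s , λ H sub preserves →
     (begin
       n * n                ≤⟨ *-mono-≤ n≤52k n≤52k ⟩
       (52 * k) * (52 * k)  ≡⟨ solve 1 (λ k → (con 52 :* k) :* (con 52 :* k) := con 2704 :* (k :* k)) refl k ⟩
       2704 * (k * k)       ≤⟨ *-monoʳ-≤ 2704 (k²≤size H sub preserves) ⟩
       2704 * size H        ∎)
     , ≤-trans (size≤n*n H) (≤-reflexive (sym (*-identityˡ (n * n))))
  where open ≤-Reasoning
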